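{- Let $\mathcal G=(V,E)$ be a graph without loops that is quasi-projective (within the class of loopless graphs). Then $\mathcal G$ is a complete graph or an empty graph.
   Context: Graphs are undirected: $E$ is a set of unordered pairs of vertices (equivalently a symmetric relation on $V$); here loops are not allowed, so all graphs considered (including the targets $\mathcal T$ below) are loopless. A homomorphism is a map of vertices sending edges to edges; an epimorphism is a surjective homomorphism. A graph $\mathcal S$ is quasi-projective if for every loopless graph $\mathcal T$, every homomorphism $f:\mathcal S\to\mathcal T$ and every epimorphism $j:\mathcal S\to\mathcal T$, there is an endomorphism $\phi$ of $\mathcal S$ with $j\circ\phi=f$. The graph is empty if $E=\emptyset$, and complete if every two distinct vertices are joined by an edge. -}

module Defs where

open import Level using (0ℓ)
open import Data.Empty using (⊥)
open import Data.Product using (Σ; ∃; _×_; _,_)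
open import Relation.Nullary using (¬_)
open import Relation.Binary.PropositionalEquality using (_≡_; _≢_)

record Graph : Set₁ where
  field
    V     : Set
    E     : V → V → Set
    sym   : ∀ {x y} → E x y → E y x
    noLoop : ∀ x → ¬ E x x
open Graph public

IsHom : (S T : Graph) → (V S → V T) → Set
IsHom S T f = ∀ {x y} → E S x y → E T (f x) (f y)

Hom : Graph → Graph → Set
Hom S T = Σ (V S → V T) (IsHom S T)

IsEpi : (S T : Graph) → (V S → V T) → Set
IsEpi S T j = IsHom S T j × (∀ t → ∃ λ s → j s ≡ t)

QuasiProjective : Graph → Set₁
QuasiProjective S =
  (T : Graph) (f j : V S → V T) → IsHom S T f → IsEpi S T j →
  ∃ λ (φ : V S → V S) → IsHom S S φ × (∀ x → j (φ x) ≡ f x)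

IsEmptyGraph : Graph → Set
IsEmptyGraph G = ∀ x y → ¬ E G x y

IsComplete : Graph → Set
IsComplete G = ∀ x y → x ≢ y → E G x y

{-# OPTIONS --safe #-}
module Submission where

-- If G has an edge a b and two distinct vertices x y, some injection of V sends a, b to
-- x, y. Every injection is a homomorphism into the complete graph on V, onto which the
-- identity is an epimorphism; quasi-projectivity lifts it through the identity, so the
-- injection itself is an endomorphism of G and x y is an edge.

open import Defs hiding (sym)
open import Level using (0ℓ)
open import Data.Sum using (_⊎_; inj₁; inj₂)
open import Data.Product using (∃; ∃₂; _×_; _,_)
open import Function.Base using (id; _∘_)
open import Function.Definitions using (Injective)
import Function.Construct.Composition as Compose
open import Axiom.ExcludedMiddle using (ExcludedMiddle)
open import Relation.Nullary using (yes; no)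
open import Relation.Binary.Definitions using (DecidableEquality)
open import Relation.Binary.PropositionalEquality
  using (_≡_; _≢_; refl; sym; trans; cong; subst₂; ≢-sym; module ≡-Reasoning)

module Transposition {A : Set} (_≟_ : DecidableEquality A) where

  transpose : A → A → A → A
  transpose p q v with v ≟ p | v ≟ q
  ... | yes _ | _     = q
  ... | no _  | yes _ = p
  ... | no _  | no _  = v

  transpose-left : ∀ p q → transpose p q p ≡ q
  transpose-left p q with p ≟ p
  ... | yes _  = refl
  ... | no p≢p with () ← p≢p refl

  transpose-right : ∀ p q → transpose p q q ≡ p
  transpose-right p q with q ≟ p | q ≟ q
  ... | yes q≡p | _      = q≡p
  ... | no _    | yes _  = refl
  ... | no _    | no q≢q with () ← q≢q refl

  transpose-fixed : ∀ {p q v} → v ≢ p → v ≢ q → transpose p q v ≡ v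
  transpose-fixed {p} {q} {v} v≢p v≢q with v ≟ p | v ≟ q
  ... | yes v≡p | _       with () ← v≢p v≡p
  ... | no _    | yes v≡q with () ← v≢q v≡q
  ... | no _    | no _    = refl

  transpose-involutive : ∀ p q v → transpose p q (transpose p q v) ≡ v
  transpose-involutive p q v with v ≟ p | v ≟ q
  ... | yes refl | _       = transpose-right v q
  ... | no _     | yes refl = transpose-left p v
  ... | no v≢p   | no v≢q  = transpose-fixed v≢p v≢q

  transpose-injective : ∀ p q → Injective _≡_ _≡_ (transpose p q)
  transpose-injective p q {u} {v} eq = begin
    u                                   ≡⟨ sym (transpose-involutive p q u) ⟩
    transpose p q (transpose p q u)     ≡⟨ cong (transpose p q) eq ⟩
    transpose p q (transpose p q v)     ≡⟨ transpose-involutive p q v ⟩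
    v                                   ∎
    where open ≡-Reasoning

  ∃-injection-mapping-pair : ∀ {a b x y} → a ≢ b → x ≢ y →
    ∃ λ (f : A → A) → Injective _≡_ _≡_ f × f a ≡ x × f b ≡ y
  ∃-injection-mapping-pair {a} {b} {x} {y} a≢b x≢y =
    τ₂ ∘ τ₁ , inj , τ₂τ₁a≡x , transpose-left (τ₁ b) y
    where
    τ₁ τ₂ : A → A
    τ₁ = transpose a x
    τ₂ = transpose (τ₁ b) y

    inj : Injective _≡_ _≡_ (τ₂ ∘ τ₁)
    inj = Compose.injective _≡_ _≡_ _≡_
            (transpose-injective a x) (transpose-injective (τ₁ b) y)

    x≢τ₁b : x ≢ τ₁ b
    x≢τ₁b x≡τ₁b = a≢b (transpose-injective a x (trans (transpose-left a x) x≡τ₁b))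

    τ₂τ₁a≡x : τ₂ (τ₁ a) ≡ x
    τ₂τ₁a≡x = trans (cong τ₂ (transpose-left a x)) (transpose-fixed x≢τ₁b x≢y)

completeGraph : Set → Graph
completeGraph A = record
  { V      = A
  ; E      = _≢_
  ; sym    = ≢-sym
  ; noLoop = λ _ x≢x → x≢x refl
  }

module _ (G : Graph) where

  edge⇒≢ : ∀ {x y} → E G x y → x ≢ y
  edge⇒≢ {x} {y} e refl = noLoop G x e

  injective⇒hom-complete : ∀ {B} {f : V G → B} → Injective _≡_ _≡_ f →
    IsHom G (completeGraph B) f
  injective⇒hom-complete f-inj e = edge⇒≢ e ∘ f-inj

  id-epi-complete : IsEpi G (completeGraph (V G)) id
  id-epi-complete = injective⇒hom-complete id , λ t → t , refl

  quasiProjective⇒injection-endo : QuasiProjective G →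
    ∀ {f : V G → V G} → Injective _≡_ _≡_ f → IsHom G G f
  quasiProjective⇒injection-endo qp {f} f-inj {x} {y} e
    with φ , φ-hom , φ≗f ← qp (completeGraph (V G)) f id
                              (injective⇒hom-complete f-inj) id-epi-complete
    = subst₂ (E G) (φ≗f x) (φ≗f y) (φ-hom e)

  quasiProjective-edge⇒complete : DecidableEquality (V G) → QuasiProjective G →
    ∀ {a b} → E G a b → IsComplete G
  quasiProjective-edge⇒complete _≟_ qp eab x y x≢y
    with f , f-inj , fa≡x , fb≡y ←
           Transposition.∃-injection-mapping-pair _≟_ (edge⇒≢ eab) x≢y
    = subst₂ (E G) fa≡x fb≡y (quasiProjective⇒injection-endo qp f-inj eab)

lemma4p1 : ExcludedMiddle 0ℓ → (G : Graph) → QuasiProjective G →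
    IsComplete G ⊎ IsEmptyGraph G
lemma4p1 em G qp with em {∃₂ (E G)}
... | yes (_ , _ , eab) = inj₁ (quasiProjective-edge⇒complete G (λ _ _ → em) qp eab)
... | no no-edge        = inj₂ λ x y e → no-edge (x , y , e)
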